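{- Let $\kappa\geq\omega$, let $U$ be an ultrafilter over $\kappa$, and let $\mathbb{P}$ be any directed set. The following are equivalent: (1) $\mathbb{P}\leq_T (U,\supseteq)$. (2) There is a thin cover $X\in M_U$ of $j_U''\mathbb{P}$, i.e. an $X\in M_U$ such that $M_U\models j_U(p)\in X$ for every $p\in\mathbb{P}$, and such that for every unbounded set $\mathcal{A}\subseteq\mathbb{P}$, $j_U(\mathcal{A})\not\subseteq X$ (meaning there is $q$ with $M_U\models q\in j_U(\mathcal{A})\wedge q\notin X$).
   Context: A directed set is a partially ordered set in which any two elements have a common upper bound. A subset of a directed set is unbounded if it has no upper bound. For directed sets $\mathbb{P},\mathbb{Q}$, a Tukey map $f:\mathbb{P}\to\mathbb{Q}$ is a map sending every unbounded subset of $\mathbb{P}$ to an unbounded subset of $\mathbb{Q}$; $\mathbb{P}\leq_T\mathbb{Q}$ means there is a Tukey map from $\mathbb{P}$ to $\mathbb{Q}$. For an ultrafilter $U$, $(U,\supseteq)$ is $U$ ordered by reverse inclusion (so an upper bound of $\mathcal{A}\subseteq U$ is some $B\in U$ contained in every member of $\mathcal{A}$). $j_U:V\to M_U$ denotes the ultrapower embedding by $U$ (the ultrapower $M_U$ need not be well-founded; membership in $M_U$ is always meant in the sense of $M_U$). -}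

module Defs where

open import Level using (0ℓ; _⊔_; suc)
open import Data.Product using (Σ; _×_; _,_; proj₁)
open import Data.Sum using (_⊎_)
open import Data.Empty using (⊥)
open import Relation.Nullary using (¬_)
open import Relation.Unary using (Pred; _⊆_; ∁; _∩_; U; ∅)
open import Relation.Binary.Core using (Rel)
open import Relation.Binary.Bundles using (Poset)
open import Relation.Binary.PropositionalEquality using (_≡_)

record DirectedSet : Set₁ where
  field
    poset    : Poset 0ℓ 0ℓ 0ℓ
  open Poset poset public
  field
    directed : ∀ x y → Σ Carrier (λ z → (x ≤ z) × (y ≤ z))

IsUpperBound : ∀ {a r s} {A : Set a} → Rel A r → Pred A s → A → Set (a ⊔ r ⊔ s)
IsUpperBound _≤_ S b = ∀ x → S x → x ≤ b

Unbounded : ∀ {a r s} {A : Set a} → Rel A r → Pred A s → Set (a ⊔ r ⊔ s)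
Unbounded {A = A} _≤_ S = ¬ Σ A (IsUpperBound _≤_ S)

image : ∀ {a b s} {A : Set a} {B : Set b} → (A → B) → Pred A s → Pred B (a ⊔ b ⊔ s)
image {A = A} f S y = Σ A (λ x → S x × (f x ≡ y))

IsTukeyMap : ∀ {a b r₁ r₂} {A : Set a} {B : Set b} →
             Rel A r₁ → Rel B r₂ → (A → B) → Set (suc 0ℓ ⊔ a ⊔ b ⊔ r₁ ⊔ r₂)
IsTukeyMap _≤₁_ _≤₂_ f = ∀ (S : Pred _ 0ℓ) → Unbounded _≤₁_ S → Unbounded _≤₂_ (image f S)

TukeyBelow : ∀ {a b r₁ r₂} {A : Set a} {B : Set b} →
             Rel A r₁ → Rel B r₂ → Set (suc 0ℓ ⊔ a ⊔ b ⊔ r₁ ⊔ r₂)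
TukeyBelow {A = A} {B = B} _≤₁_ _≤₂_ = Σ (A → B) (IsTukeyMap _≤₁_ _≤₂_)

record Ultrafilter (K : Set) : Set₁ where
  field
    member   : Pred (Pred K 0ℓ) 0ℓ
    full     : member U
    proper   : ¬ member ∅
    upward   : ∀ {A B} → A ⊆ B → member A → member B
    meet     : ∀ {A B} → member A → member B → member (A ∩ B)
    ultra    : ∀ A → member A ⊎ member (∁ A)

module _ {K : Set} (𝒰 : Ultrafilter K) where
  open Ultrafilter 𝒰

  UElem : Set₁
  UElem = Σ (Pred K 0ℓ) member

  _≤⊇_ : Rel UElem 0ℓ
  X ≤⊇ Y = proj₁ Y ⊆ proj₁ X

-- The ultrapower M_U, restricted to the part needed for the statement,
-- for a ground set D (here the carrier of ℙ).  An element of M_U is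
-- represented by a function K → V; we use
--   * representatives g : K → D      of elements of j_U(D),
--   * representatives h : K → Pred D of subsets of j_U(D) in M_U,
-- and membership in M_U is  [g] ∈ [h]  iff  {α | g α ∈ h α} ∈ U.

module Ultrapower {K : Set} (𝒰 : Ultrafilter K) (D : Set) where
  open Ultrafilter 𝒰

  Elt : Set
  Elt = K → D

  SubsetRep : Set₁
  SubsetRep = K → Pred D 0ℓ

  _∈M_ : Elt → SubsetRep → Set
  g ∈M h = member (λ α → h α (g α))

  _∉M_ : Elt → SubsetRep → Set
  g ∉M h = ¬ (g ∈M h)

  j : D → Elt
  j p = λ _ → p

  jSet : Pred D 0ℓ → SubsetRep
  jSet A = λ _ → A

module _ {K : Set} (𝒰 : Ultrafilter K) (ℙ : DirectedSet) where
  open DirectedSet ℙ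
  open Ultrapower 𝒰 Carrier

  IsThinCover : SubsetRep → Set₁
  IsThinCover X =
      (∀ p → j p ∈M X)
    × (∀ (𝒜 : Pred Carrier 0ℓ) → Unbounded _≤_ 𝒜 →
         Σ Elt (λ q → (q ∈M jSet 𝒜) × (q ∉M X)))

{-# OPTIONS --safe #-}
module Submission where

-- A Tukey map f : ℙ → (U, ⊇) and a thin cover X are two readings of one
-- relation α ∈ f(p) ⇔ p ∈ X_α.  Given f, the cover X = [α ↦ {p | α ∈ f(p)}]
-- contains j(p) because f(p) ∈ U; if 𝒜 is unbounded then ⋂ f''𝒜 ∉ U (else it
-- would bound f''𝒜), so choosing for each α some q(α) ∈ 𝒜 with α ∉ f(q(α))
-- whenever possible gives [q] ∈ j(𝒜) with [q] ∉ X.  Conversely, given X, the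
-- map f(p) = {α | p ∈ X_α} is Tukey: a bound B ∈ U of f''𝒜 would put
-- B ∩ {α | q(α) ∈ 𝒜} ∈ U inside {α | q(α) ∈ X_α}, so [q] ∈ X.

open import Defs
open import Data.Nat using (ℕ)
open import Data.Product using (Σ; _×_; _,_; proj₁; proj₂)
open import Data.Empty using (⊥-elim)
open import Function.Bundles using (_↣_; _⇔_; mk⇔)
open import Axiom.ExcludedMiddle using (ExcludedMiddle)
open import Axiom.DoubleNegationElimination using (DoubleNegationElimination; em⇒dne)
open import Level using (Level; 0ℓ)
open import Relation.Nullary using (¬_; yes; no)
open import Relation.Unary using (Pred)
open import Relation.Binary.PropositionalEquality using (refl)

private
  variable
    ℓ : Level

ε-choice : ExcludedMiddle ℓ → {A : Set ℓ} → A → (P : Pred A ℓ) →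
           Σ A (λ a → Σ A P → P a)
ε-choice em {A} a₀ P with em {Σ A P}
... | yes (a , Pa) = a , λ _ → Pa
... | no ∄P        = a₀ , λ ∃P → ⊥-elim (∄P ∃P)

module _ {K : Set} (𝒰 : Ultrafilter K) where
  open Ultrafilter 𝒰

  ⋂ : {A : Set} → Pred A 0ℓ → (A → UElem 𝒰) → Pred K 0ℓ
  ⋂ 𝒜 F α = ∀ a → 𝒜 a → proj₁ (F a) α

  ⋂-isUpperBound : {A : Set} (𝒜 : Pred A 0ℓ) (F : A → UElem 𝒰) (m : member (⋂ 𝒜 F)) →
                   IsUpperBound (_≤⊇_ 𝒰) (image F 𝒜) (⋂ 𝒜 F , m)
  ⋂-isUpperBound 𝒜 F m _ (a , a∈𝒜 , refl) ⋂α = ⋂α a a∈𝒜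

  unbounded-image⇒⋂∉ : {A : Set} (𝒜 : Pred A 0ℓ) (F : A → UElem 𝒰) →
                       Unbounded (_≤⊇_ 𝒰) (image F 𝒜) → ¬ member (⋂ 𝒜 F)
  unbounded-image⇒⋂∉ 𝒜 F unb m = unb ((⋂ 𝒜 F , m) , ⋂-isUpperBound 𝒜 F m)

module _ {K : Set} (𝒰 : Ultrafilter K) (ℙ : DirectedSet) where
  open Ultrafilter 𝒰
  open DirectedSet ℙ using (Carrier; _≤_)
  open Ultrapower 𝒰 Carrier

  coverOf : (Carrier → UElem 𝒰) → SubsetRep
  coverOf f α p = proj₁ (f p) α

  j∈coverOf : (f : Carrier → UElem 𝒰) → ∀ p → j p ∈M coverOf f
  j∈coverOf f p = proj₂ (f p)

  coverOf-escapes : ExcludedMiddle 0ℓ → (f : Carrier → UElem 𝒰) →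
                    IsTukeyMap _≤_ (_≤⊇_ 𝒰) f →
                    (𝒜 : Pred Carrier 0ℓ) → Unbounded _≤_ 𝒜 →
                    Σ Elt (λ q → (q ∈M jSet 𝒜) × (q ∉M coverOf f))
  coverOf-escapes em f tukey 𝒜 unb = q , q∈j𝒜 , q∉X
    where
    dne : DoubleNegationElimination 0ℓ
    dne = em⇒dne em

    ⋂∉ : ¬ member (⋂ 𝒰 𝒜 f)
    ⋂∉ = unbounded-image⇒⋂∉ 𝒰 𝒜 f (tukey 𝒜 unb)

    -- An empty 𝒜 would make ⋂ f''𝒜 the whole of K.
    a₀ : Σ Carrier 𝒜
    a₀ = dne λ ∄a → ⋂∉ (upward (λ _ a a∈𝒜 → ⊥-elim (∄a (a , a∈𝒜))) full)

    Misses : K → Pred (Σ Carrier 𝒜) 0ℓ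
    Misses α (a , _) = ¬ proj₁ (f a) α

    choice : (α : K) → Σ (Σ Carrier 𝒜) (λ a → Σ (Σ Carrier 𝒜) (Misses α) → Misses α a)
    choice α = ε-choice em a₀ (Misses α)

    q : Elt
    q α = proj₁ (proj₁ (choice α))

    q∈j𝒜 : q ∈M jSet 𝒜
    q∈j𝒜 = upward (λ {α} _ → proj₂ (proj₁ (choice α))) full

    hit⇒⋂ : ∀ {α} → coverOf f α (q α) → ⋂ 𝒰 𝒜 f α
    hit⇒⋂ {α} hit a a∈𝒜 = dne λ miss → proj₂ (choice α) ((a , a∈𝒜) , miss) hit

    q∉X : q ∉M coverOf f
    q∉X m = ⋂∉ (upward hit⇒⋂ m)

  tukeyMap⇒thinCover : ExcludedMiddle 0ℓ → TukeyBelow _≤_ (_≤⊇_ 𝒰) →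
                       Σ SubsetRep (IsThinCover 𝒰 ℙ)
  tukeyMap⇒thinCover em (f , tukey) = coverOf f , j∈coverOf f , coverOf-escapes em f tukey

  tukeyMapOf : (X : SubsetRep) → (∀ p → j p ∈M X) → Carrier → UElem 𝒰
  tukeyMapOf X j∈X p = (λ α → X α p) , j∈X p

  tukeyMapOf-isTukeyMap : (X : SubsetRep) (thin : IsThinCover 𝒰 ℙ X) →
                          IsTukeyMap _≤_ (_≤⊇_ 𝒰) (tukeyMapOf X (proj₁ thin))
  tukeyMapOf-isTukeyMap X (_ , escape) 𝒜 unb (B , B-bounds) with escape 𝒜 unb
  ... | q , q∈j𝒜 , q∉X =
    q∉X (upward (λ {α} (α∈B , q∈𝒜) → B-bounds _ (q α , q∈𝒜 , refl) α∈B)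
                (meet (proj₂ B) q∈j𝒜))

  thinCover⇒tukeyMap : Σ SubsetRep (IsThinCover 𝒰 ℙ) → TukeyBelow _≤_ (_≤⊇_ 𝒰)
  thinCover⇒tukeyMap (X , thin) = tukeyMapOf X (proj₁ thin) , tukeyMapOf-isTukeyMap X thin

mainTheorem1 : ExcludedMiddle 0ℓ →
    (K : Set) → (ℕ ↣ K) → (𝒰 : Ultrafilter K) → (ℙ : DirectedSet) →
    TukeyBelow (DirectedSet._≤_ ℙ) (_≤⊇_ 𝒰)
    ⇔ Σ (Ultrapower.SubsetRep 𝒰 (DirectedSet.Carrier ℙ)) (IsThinCover 𝒰 ℙ)
mainTheorem1 em K _ 𝒰 ℙ = mk⇔ (tukeyMap⇒thinCover 𝒰 ℙ em) (thinCover⇒tukeyMap 𝒰 ℙ)
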